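{- For every even integer $n>1$, the string $uz(n)=1010\cdots10$ (of length $n$) is a code.
   Context: For $n\ge1$, $uz(n)$ denotes the $n$-digit decimal number whose digits, read from left to right, are $1,0,1,0,\dots$ (starting with $1$ and alternating). Code: let $x=a_na_{n-1}\dots a_1a_0$ be a positive integer with $n+1\ge 2$ decimal digits and $a_n>a_0$. Its code is the string $z_0z_1\dots z_n$ of $0$s and $1$s defined by $z_{ -1}=0$, for $i=0,\dots,n-1$: $z_i=1$ if $a_i-a_{n-i}-z_{i-1}<0$ and $z_i=0$ otherwise; and $z_n=0$ (so $z_0=1$). A finite string of $0$s and $1$s is called a code if it is the code of some such $x$. -}

module Defs where

open import Data.Nat using (ℕ; zero; suc; _+_; _*_; _∸_; _^_; _≤_; _<_; _<ᵇ_)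
open import Data.Nat.DivMod using (_/_; _%_)
open import Data.Bool using (if_then_else_)
open import Data.List using (List; []; _∷_; map; upTo; _++_; [_])
open import Data.Product using (∃; _×_)
open import Relation.Binary.PropositionalEquality using (_≡_)

-- Strings of 0s and 1s are represented as lists of natural numbers (each 0 or 1).

digit : ℕ → ℕ → ℕ
digit x zero = x % 10
digit x (suc i) = digit (x / 10) i

-- z_i of the code of x, where x = a_m ... a_0 has m+1 digits (0 ≤ i).
-- z_i = 1  iff  a_i - a_{m-i} - z_{i-1} < 0  iff  a_i < a_{m-i} + z_{i-1}, with z_{-1} = 0.
zbit : (x m i : ℕ) → ℕ
zbit x m zero    = if digit x 0 <ᵇ digit x m + 0 then 1 else 0
zbit x m (suc i) = if digit x (suc i) <ᵇ digit x (m ∸ suc i) + zbit x m i then 1 else 0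

code : (x m : ℕ) → List ℕ
code x m = map (zbit x m) (upTo m) ++ [ 0 ]

IsCode : List ℕ → Set
IsCode s = ∃ λ x → ∃ λ m →
  (1 ≤ m) × (10 ^ m ≤ x) × (x < 10 ^ suc m) × (digit x 0 < digit x m) × (code x m ≡ s)

alt : ℕ → ℕ
alt zero = 1
alt (suc zero) = 0
alt (suc (suc i)) = alt i

uz : ℕ → List ℕ
uz n = map alt (upTo n)

-- The witness is x = 1010…10 with an even number m + 1 of digits, so a_i = 1 − (i mod 2).
-- Since m is odd, a_{m−i} = 1 − a_i, and the recurrence for the code collapses to
-- z_i = [a_i < 1 − a_i + z_{i−1}]; starting from z_0 = [0 < 1] = 1 this alternates 1, 0, 1, 0, …
-- up to z_{m−1} = 0, and the final z_m = 0 completes the string uz (m + 1).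
module Submission where

open import Defs
open import Data.Bool using (if_then_else_)
open import Data.List using (_∷_; map; upTo; applyUpTo; _++_; [_])
open import Data.List.Properties using (map-upTo; applyUpTo-∷ʳ)
open import Data.Nat using (ℕ; zero; suc; _+_; _*_; _∸_; _^_; _/_; _%_; _≤_; _<_; _<ᵇ_; z≤n; s≤s)
open import Data.Nat.Properties
open import Data.Nat.DivMod using ([m+kn]%n≡m%n; m<n⇒m%n≡m; m<n⇒m/n≡0; m*n/n≡m; +-distrib-/-∣ʳ)
open import Data.Nat.Divisibility using (divides; divides-refl; m%n≡0⇒n∣m)
open import Data.Nat.Tactic.RingSolver using (solve-∀)
open import Data.Product using (_,_)
open import Relation.Binary.PropositionalEquality using (_≡_; refl; sym; trans; cong; cong₂; module ≡-Reasoning)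

digit-+*10-zero : ∀ d y → d < 10 → digit (d + y * 10) 0 ≡ d
digit-+*10-zero d y d<10 = trans ([m+kn]%n≡m%n d y 10) (m<n⇒m%n≡m d<10)

digit-+*10-suc : ∀ d y j → d < 10 → digit (d + y * 10) (suc j) ≡ digit y j
digit-+*10-suc d y j d<10 = cong (λ t → digit t j) (begin
  (d + y * 10) / 10    ≡⟨ +-distrib-/-∣ʳ d (divides-refl y) ⟩
  d / 10 + y * 10 / 10 ≡⟨ cong₂ _+_ (m<n⇒m/n≡0 d<10) (m*n/n≡m y 10) ⟩
  y                    ∎)
  where open ≡-Reasoning

alt-even : ∀ k → alt (k * 2) ≡ 1
alt-even zero    = refl
alt-even (suc k) = alt-even k

alt-odd : ∀ k → alt (suc (k * 2)) ≡ 0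
alt-odd zero    = refl
alt-odd (suc k) = alt-odd k

alt-even-∸ : ∀ k i → i ≤ k * 2 → alt (k * 2 ∸ i) ≡ alt i
alt-even-∸ k       zero          _                 = alt-even k
alt-even-∸ (suc k) (suc zero)    _                 = alt-odd k
alt-even-∸ (suc k) (suc (suc i)) (s≤s (s≤s i≤2k)) = alt-even-∸ k i i≤2k

alt-step : ∀ i → (if alt i <ᵇ alt (suc i) + alt i then 1 else 0) ≡ alt (suc i)
alt-step zero          = refl
alt-step (suc zero)    = refl
alt-step (suc (suc i)) = alt-step i

alternating : ℕ → ℕ
alternating zero    = 0
alternating (suc k) = (1 + alternating k * 10) * 10

digit-alternating : ∀ k i → i < k * 2 → digit (alternating k) i ≡ alt (suc i)
digit-alternating (suc k) zero          _ = digit-+*10-zero 0 (1 + alternating k * 10) (s≤s z≤n)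
digit-alternating (suc k) (suc zero)    _ =
  trans (digit-+*10-suc 0 (1 + alternating k * 10) 0 (s≤s z≤n))
        (digit-+*10-zero 1 (alternating k) (s≤s (s≤s z≤n)))
digit-alternating (suc k) (suc (suc i)) (s≤s (s≤s i<2k)) = begin
  digit (alternating (suc k)) (suc (suc i)) ≡⟨ digit-+*10-suc 0 (1 + alternating k * 10) (suc i) (s≤s z≤n) ⟩
  digit (1 + alternating k * 10) (suc i)    ≡⟨ digit-+*10-suc 1 (alternating k) i (s≤s (s≤s z≤n)) ⟩
  digit (alternating k) i                   ≡⟨ digit-alternating k i i<2k ⟩
  alt (suc i)                               ∎
  where open ≡-Reasoning

digit-alternating-mirror : ∀ k i → i ≤ suc (k * 2) →
  digit (alternating (suc k)) (suc (k * 2) ∸ i) ≡ alt i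
digit-alternating-mirror k i i≤m = begin
  digit (alternating (suc k)) (suc (k * 2) ∸ i) ≡⟨ digit-alternating (suc k) _ (s≤s (m∸n≤m (suc (k * 2)) i)) ⟩
  alt (suc (suc (k * 2) ∸ i))                   ≡⟨ cong alt (sym (+-∸-assoc 1 i≤m)) ⟩
  alt (suc k * 2 ∸ i)                           ≡⟨ alt-even-∸ (suc k) i (m≤n⇒m≤1+n i≤m) ⟩
  alt i                                         ∎
  where open ≡-Reasoning

zbit-alternating : ∀ k i → i < suc (k * 2) →
  zbit (alternating (suc k)) (suc (k * 2)) i ≡ alt i
zbit-alternating k zero _
  rewrite digit-alternating (suc k) 0 (s≤s z≤n)
        | digit-alternating-mirror k 0 z≤n = refl
zbit-alternating k (suc i) i<m
  rewrite digit-alternating (suc k) (suc i) (m≤n⇒m≤1+n i<m)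
        | digit-alternating-mirror k (suc i) (<⇒≤ i<m)
        | zbit-alternating k i (<-trans (n<1+n i) i<m) = alt-step i

alternating-< : ∀ k → alternating k < 10 ^ (k * 2)
alternating-< zero    = s≤s z≤n
alternating-< (suc k) = begin-strict
  (1 + a * 10) * 10   ≡⟨ expand a ⟩
  10 + a * 100        <⟨ +-monoˡ-< (a * 100) {10} {100} (s≤s (m≤m+n 10 89)) ⟩
  suc a * 100         ≤⟨ *-monoˡ-≤ 100 (alternating-< k) ⟩
  10 ^ (k * 2) * 100  ≡⟨ *-comm (10 ^ (k * 2)) 100 ⟩
  100 * 10 ^ (k * 2)  ≡⟨ *-assoc 10 10 (10 ^ (k * 2)) ⟩
  10 ^ (suc k * 2)    ∎
  where
  open ≤-Reasoning
  a : ℕ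
  a = alternating k
  expand : ∀ x → (1 + x * 10) * 10 ≡ 10 + x * 100
  expand = solve-∀

alternating-≥ : ∀ k → 10 ^ suc (k * 2) ≤ alternating (suc k)
alternating-≥ zero    = ≤-refl
alternating-≥ (suc k) = begin
  10 ^ suc (suc k * 2)    ≡⟨ *-assoc 10 10 (10 ^ suc (k * 2)) ⟨
  100 * 10 ^ suc (k * 2)  ≡⟨ *-comm 100 (10 ^ suc (k * 2)) ⟩
  10 ^ suc (k * 2) * 100  ≤⟨ *-monoˡ-≤ 100 (alternating-≥ k) ⟩
  a * 100                 ≤⟨ m≤n+m (a * 100) 10 ⟩
  10 + a * 100            ≡⟨ expand a ⟩
  (1 + a * 10) * 10       ∎
  where
  open ≤-Reasoning
  a : ℕ
  a = alternating (suc k)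
  expand : ∀ x → 10 + x * 100 ≡ (1 + x * 10) * 10
  expand = solve-∀

applyUpTo-cong : ∀ {A : Set} (f g : ℕ → A) n → (∀ i → i < n → f i ≡ g i) →
  applyUpTo f n ≡ applyUpTo g n
applyUpTo-cong f g zero    _   = refl
applyUpTo-cong f g (suc n) f≡g = cong₂ _∷_ (f≡g 0 (s≤s z≤n))
  (applyUpTo-cong (λ i → f (suc i)) (λ i → g (suc i)) n (λ i i<n → f≡g (suc i) (s≤s i<n)))

code-alternating : ∀ k → code (alternating (suc k)) (suc (k * 2)) ≡ uz (suc k * 2)
code-alternating k = begin
  map z (upTo m) ++ [ 0 ]      ≡⟨ cong (_++ [ 0 ]) (map-upTo z m) ⟩
  applyUpTo z m ++ [ 0 ]       ≡⟨ cong₂ (λ xs b → xs ++ [ b ])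
                                    (applyUpTo-cong z alt m (zbit-alternating k)) (sym (alt-odd k)) ⟩
  applyUpTo alt m ++ [ alt m ] ≡⟨ applyUpTo-∷ʳ alt m ⟩
  applyUpTo alt (suc m)        ≡⟨ map-upTo alt (suc m) ⟨
  map alt (upTo (suc m))       ∎
  where
  open ≡-Reasoning
  m : ℕ
  m = suc (k * 2)
  z : ℕ → ℕ
  z = zbit (alternating (suc k)) m

uz-even-isCode : ∀ k → IsCode (uz (suc k * 2))
uz-even-isCode k =
  alternating (suc k) , suc (k * 2) , s≤s z≤n , alternating-≥ k , alternating-< (suc k) ,
  leading>trailing , code-alternating k
  where
  leading>trailing : digit (alternating (suc k)) 0 < digit (alternating (suc k)) (suc (k * 2))
  leading>trailing rewrite digit-alternating (suc k) 0 (s≤s z≤n)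
                         | digit-alternating-mirror k 0 z≤n = s≤s z≤n

proposition10 : (n : ℕ) → 1 < n → n % 2 ≡ 0 → IsCode (uz n)
proposition10 n 1<n n%2≡0 with m%n≡0⇒n∣m n 2 n%2≡0
proposition10 .0           () _ | divides zero    refl
proposition10 .(suc k * 2) _  _ | divides (suc k) refl = uz-even-isCode k
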